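{- Let $\tau$ be a skew shape. Then $\tau$ is cornered if and only if $\tau$ is connected.
   Context: Nodes are elements of $\mathbb{Z}\times\mathbb{Z}$; $u=(u_1,u_2)$ lies in row $u_1$ (increasing southward), column $u_2$ (increasing eastward). ${\sf N}(i,j)=(i-1,j)$, ${\sf E}(i,j)=(i,j+1)$, ${\sf S}(i,j)=(i+1,j)$, ${\sf W}(i,j)=(i,j-1)$. $u\searrow v$ means $v=u+(k,\ell)$ with $k,\ell\ge0$. A finite set $\tau$ of nodes is a skew shape if $u,w\in\tau$, $v$ a node, $u\searrow v\searrow w$ imply $v\in\tau$; connected if for any $u,v\in\tau$ there is a sequence of nodes in $\tau$ from $u$ to $v$, each obtained from the previous by one of ${\sf N},{\sf E},{\sf S},{\sf W}$. $\tau$ is cornered if there is at most one $u\in\tau$ with ${\sf S}u\notin\tau$ and ${\sf W}u\notin\tau$, and at most one $v\in\tau$ with ${\sf N}v\notin\tau$ and ${\sf E}v\notin\tau$. -}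

module Defs where

open import Data.Nat using (ℕ)
open import Data.Integer using (ℤ; +_; _+_; _-_; 1ℤ)
open import Data.Product using (_×_; _,_; Σ; proj₁; proj₂)
open import Data.Sum using (_⊎_)
open import Data.List using (List)
open import Data.List.Membership.Propositional using (_∈_; _∉_)
open import Relation.Binary.PropositionalEquality using (_≡_)

-- Nodes: (row, column); rows increase southward, columns eastward.
Node : Set
Node = ℤ × ℤ

N E S W : Node → Node
N (i , j) = (i - 1ℤ , j)
E (i , j) = (i , j + 1ℤ)
S (i , j) = (i + 1ℤ , j)
W (i , j) = (i , j - 1ℤ)

_↘_ : Node → Node → Set
u ↘ v = Σ ℕ λ k → Σ ℕ λ ℓ → v ≡ (proj₁ u + + k , proj₂ u + + ℓ)

IsSkewShape : List Node → Set
IsSkewShape τ = ∀ (u v w : Node) → u ∈ τ → w ∈ τ → u ↘ v → v ↘ w → v ∈ τ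

Adjacent : Node → Node → Set
Adjacent u v = v ≡ N u ⊎ v ≡ E u ⊎ v ≡ S u ⊎ v ≡ W u

data Walk (τ : List Node) : Node → Node → Set where
  here : ∀ {u} → u ∈ τ → Walk τ u u
  step : ∀ {u w v} → u ∈ τ → Adjacent u w → Walk τ w v → Walk τ u v

IsConnected : List Node → Set
IsConnected τ = ∀ (u v : Node) → u ∈ τ → v ∈ τ → Walk τ u v

IsCornered : List Node → Set
IsCornered τ =
  (∀ (u u' : Node) → u ∈ τ → S u ∉ τ → W u ∉ τ
                   → u' ∈ τ → S u' ∉ τ → W u' ∉ τ → u ≡ u')
  × (∀ (v v' : Node) → v ∈ τ → N v ∉ τ → E v ∉ τ
                   → v' ∈ τ → N v' ∉ τ → E v' ∉ τ → v ≡ v')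

module Submission where

-- If c is a south-west corner of a skew shape τ, no walk in τ starting weakly north-east of c
-- ever leaves that quadrant: stepping south out of row c₁, or west out of column c₂, would by
-- convexity of τ put S c or W c into τ. Hence in a connected skew shape two south-west corners
-- each lie north-east of the other, so they coincide; dually for north-east corners.
-- Conversely, stepping south or west inside τ as long as possible strictly increases
-- row − column, which is bounded on τ, so every node is joined to a south-west corner; if that
-- corner is unique, any two nodes are joined through it.

open import Defs
open import Data.Nat using (ℕ; zero; suc; s≤s; z≤n)
open import Data.Integer using (ℤ; +_; -[1+_]; _+_; _-_; 1ℤ; -1ℤ; 0ℤ; ∣_∣; _≤_; +<+; -≤+)
import Data.Integer.Properties as ℤ
open import Data.Integer.Tactic.RingSolver using (solve-∀)
open import Data.List using (List; map)
open import Data.List.Membership.Propositional using (_∈_; _∉_)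
import Data.List.Membership.DecPropositional as DecMembership
import Data.List.Relation.Unary.All as All
open import Data.List.Relation.Unary.All.Properties using (map⁻)
open import Data.List.Extrema ℤ.≤-totalOrder using (max; xs≤max)
open import Data.Product using (_×_; _,_; Σ; ∃-syntax)
open import Data.Product.Properties using (≡-dec)
open import Data.Sum using (inj₁; inj₂)
open import Data.Empty using (⊥-elim)
open import Relation.Nullary using (yes; no)
open import Relation.Binary.PropositionalEquality
open import Relation.Binary.Definitions using (DecidableEquality)

_≟ₙ_ : DecidableEquality Node
_≟ₙ_ = ≡-dec ℤ._≟_ ℤ._≟_

open DecMembership _≟ₙ_ using (_∈?_)

≤⇒≡+ : ∀ {i j : ℤ} → i ≤ j → Σ ℕ λ k → j ≡ i + + k
≤⇒≡+ {i} {j} i≤j = ∣ j - i ∣ , (begin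
  j                ≡⟨ j≡i+[j-i] i j ⟩
  i + (j - i)      ≡⟨ cong (λ k → i + k) (sym (ℤ.0≤i⇒+∣i∣≡i (ℤ.i≤j⇒0≤j-i i≤j))) ⟩
  i + + ∣ j - i ∣  ∎)
  where
  open ≡-Reasoning
  j≡i+[j-i] : ∀ (i j : ℤ) → j ≡ i + (j - i)
  j≡i+[j-i] = solve-∀

≤×≤⇒↘ : ∀ {i j i′ j′} → i ≤ i′ → j ≤ j′ → (i , j) ↘ (i′ , j′)
≤×≤⇒↘ i≤i′ j≤j′ with ≤⇒≡+ i≤i′ | ≤⇒≡+ j≤j′
... | k , refl | ℓ , refl = k , ℓ , refl

i≤j+∣i-j∣ : ∀ (i j : ℤ) → i ≤ j + + ∣ i - j ∣
i≤j+∣i-j∣ i j = subst (_≤ j + + ∣ i - j ∣) (i≡j+[i-j] i j) (ℤ.+-monoʳ-≤ j (k≤+∣k∣ (i - j)))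
  where
  i≡j+[i-j] : ∀ (i j : ℤ) → j + (i - j) ≡ i
  i≡j+[i-j] = solve-∀
  k≤+∣k∣ : ∀ k → k ≤ + ∣ k ∣
  k≤+∣k∣ (+ n)    = ℤ.≤-refl
  k≤+∣k∣ -[1+ n ] = -≤+

i-1≤i : ∀ (i : ℤ) → i - 1ℤ ≤ i
i-1≤i i = ℤ.i≤j⇒i-k≤j 1ℤ ℤ.≤-refl

i≤i+1 : ∀ (i : ℤ) → i ≤ i + 1ℤ
i≤i+1 i = ℤ.i≤i+j i 1ℤ

≤∧≢⇒+1≤ : ∀ {i j : ℤ} → i ≤ j → i ≢ j → i + 1ℤ ≤ j
≤∧≢⇒+1≤ {i} i≤j i≢j = subst (_≤ _) (ℤ.+-comm 1ℤ i) (ℤ.i<j⇒suc[i]≤j (ℤ.≤∧≢⇒< i≤j i≢j))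

≤∧≢⇒≤-1 : ∀ {i j : ℤ} → i ≤ j → i ≢ j → i ≤ j - 1ℤ
≤∧≢⇒≤-1 {j = j} i≤j i≢j = subst (_ ≤_) (ℤ.+-comm -1ℤ j) (ℤ.i<j⇒i≤pred[j] (ℤ.≤∧≢⇒< i≤j i≢j))

i-1+1≡i : ∀ (i : ℤ) → i - 1ℤ + 1ℤ ≡ i
i-1+1≡i = solve-∀

i+1-1≡i : ∀ (i : ℤ) → i + 1ℤ - 1ℤ ≡ i
i+1-1≡i = solve-∀

Adjacent-sym : ∀ {u v} → Adjacent u v → Adjacent v u
Adjacent-sym {i , j} (inj₁ refl)                = inj₂ (inj₂ (inj₁ (cong (_, j) (sym (i-1+1≡i i)))))
Adjacent-sym {i , j} (inj₂ (inj₁ refl))         = inj₂ (inj₂ (inj₂ (cong (i ,_) (sym (i+1-1≡i j)))))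
Adjacent-sym {i , j} (inj₂ (inj₂ (inj₁ refl)))  = inj₁ (cong (_, j) (sym (i+1-1≡i i)))
Adjacent-sym {i , j} (inj₂ (inj₂ (inj₂ refl)))  = inj₂ (inj₁ (cong (i ,_) (sym (i-1+1≡i j))))

module _ {τ : List Node} where

  walk-source : ∀ {u v} → Walk τ u v → u ∈ τ
  walk-source (here u∈τ)     = u∈τ
  walk-source (step u∈τ _ _) = u∈τ

  _++ʷ_ : ∀ {u v w} → Walk τ u v → Walk τ v w → Walk τ u w
  here _ ++ʷ q       = q
  step u∈τ a p ++ʷ q = step u∈τ a (p ++ʷ q)

  reverse : ∀ {u v} → Walk τ u v → Walk τ v u
  reverse (here u∈τ)     = here u∈τ
  reverse (step u∈τ a p) = reverse p ++ʷ step (walk-source p) (Adjacent-sym a) (here u∈τ)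

  walk-preserves : (P : Node → Set) → (∀ {x y} → P x → Adjacent x y → y ∈ τ → P y)
                 → ∀ {u v} → Walk τ u v → P u → P v
  walk-preserves P preserved (here _)     Pu = Pu
  walk-preserves P preserved (step _ a p) Pu =
    walk-preserves P preserved p (preserved Pu a (walk-source p))

IsSWCorner IsNECorner : List Node → Node → Set
IsSWCorner τ c = c ∈ τ × S c ∉ τ × W c ∉ τ
IsNECorner τ c = c ∈ τ × N c ∉ τ × E c ∉ τ

NorthEastOf SouthWestOf : Node → Node → Set
NorthEastOf (a , b) (i , j) = i ≤ a × b ≤ j
SouthWestOf c x = NorthEastOf x c

NorthEastOf-antisym : ∀ {c c′} → NorthEastOf c c′ → NorthEastOf c′ c → c ≡ c′
NorthEastOf-antisym {a , b} {a′ , b′} (a′≤a , b≤b′) (a≤a′ , b′≤b) =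
  cong₂ _,_ (ℤ.≤-antisym a≤a′ a′≤a) (ℤ.≤-antisym b≤b′ b′≤b)

module _ {τ : List Node} (skew : IsSkewShape τ) where

  NorthEastOf-SWCorner-preserved : ∀ {c} → IsSWCorner τ c
    → ∀ {x y} → NorthEastOf c x → Adjacent x y → y ∈ τ → NorthEastOf c y
  NorthEastOf-SWCorner-preserved _ {i , j} (i≤a , b≤j) (inj₁ refl) _ =
    ℤ.≤-trans (i-1≤i i) i≤a , b≤j
  NorthEastOf-SWCorner-preserved _ {i , j} (i≤a , b≤j) (inj₂ (inj₁ refl)) _ =
    i≤a , ℤ.≤-trans b≤j (i≤i+1 j)
  NorthEastOf-SWCorner-preserved {a , b} (c∈τ , Sc∉τ , _) {i , j} (i≤a , b≤j) (inj₂ (inj₂ (inj₁ refl))) y∈τ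
    with i ℤ.≟ a
  ... | yes refl = ⊥-elim (Sc∉τ (skew _ _ _ c∈τ y∈τ (≤×≤⇒↘ (i≤i+1 a) ℤ.≤-refl) (≤×≤⇒↘ ℤ.≤-refl b≤j)))
  ... | no i≢a   = ≤∧≢⇒+1≤ i≤a i≢a , b≤j
  NorthEastOf-SWCorner-preserved {a , b} (c∈τ , _ , Wc∉τ) {i , j} (i≤a , b≤j) (inj₂ (inj₂ (inj₂ refl))) y∈τ
    with b ℤ.≟ j
  ... | yes refl = ⊥-elim (Wc∉τ (skew _ _ _ y∈τ c∈τ (≤×≤⇒↘ i≤a ℤ.≤-refl) (≤×≤⇒↘ ℤ.≤-refl (i-1≤i b))))
  ... | no b≢j   = i≤a , ≤∧≢⇒≤-1 b≤j b≢j

  SouthWestOf-NECorner-preserved : ∀ {c} → IsNECorner τ c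
    → ∀ {x y} → SouthWestOf c x → Adjacent x y → y ∈ τ → SouthWestOf c y
  SouthWestOf-NECorner-preserved {a , b} (c∈τ , Nc∉τ , _) {i , j} (a≤i , j≤b) (inj₁ refl) y∈τ
    with a ℤ.≟ i
  ... | yes refl = ⊥-elim (Nc∉τ (skew _ _ _ y∈τ c∈τ (≤×≤⇒↘ ℤ.≤-refl j≤b) (≤×≤⇒↘ (i-1≤i a) ℤ.≤-refl)))
  ... | no a≢i   = ≤∧≢⇒≤-1 a≤i a≢i , j≤b
  SouthWestOf-NECorner-preserved {a , b} (c∈τ , _ , Ec∉τ) {i , j} (a≤i , j≤b) (inj₂ (inj₁ refl)) y∈τ
    with j ℤ.≟ b
  ... | yes refl = ⊥-elim (Ec∉τ (skew _ _ _ c∈τ y∈τ (≤×≤⇒↘ ℤ.≤-refl (i≤i+1 b)) (≤×≤⇒↘ a≤i ℤ.≤-refl)))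
  ... | no j≢b   = a≤i , ≤∧≢⇒+1≤ j≤b j≢b
  SouthWestOf-NECorner-preserved _ {i , j} (a≤i , j≤b) (inj₂ (inj₂ (inj₁ refl))) _ =
    ℤ.≤-trans a≤i (i≤i+1 i) , j≤b
  SouthWestOf-NECorner-preserved _ {i , j} (a≤i , j≤b) (inj₂ (inj₂ (inj₂ refl))) _ =
    a≤i , ℤ.≤-trans (i-1≤i j) j≤b

  connected⇒NorthEastOf-SWCorner : IsConnected τ → ∀ {c x} → IsSWCorner τ c → x ∈ τ → NorthEastOf c x
  connected⇒NorthEastOf-SWCorner connected corner@(c∈τ , _) x∈τ =
    walk-preserves (NorthEastOf _) (NorthEastOf-SWCorner-preserved corner) (connected _ _ c∈τ x∈τ)
                   (ℤ.≤-refl , ℤ.≤-refl)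

  connected⇒SouthWestOf-NECorner : IsConnected τ → ∀ {c x} → IsNECorner τ c → x ∈ τ → SouthWestOf c x
  connected⇒SouthWestOf-NECorner connected corner@(c∈τ , _) x∈τ =
    walk-preserves (SouthWestOf _) (SouthWestOf-NECorner-preserved corner) (connected _ _ c∈τ x∈τ)
                   (ℤ.≤-refl , ℤ.≤-refl)

  connected⇒cornered : IsConnected τ → IsCornered τ
  connected⇒cornered connected =
    (λ c c′ c∈τ Sc∉τ Wc∉τ c′∈τ Sc′∉τ Wc′∉τ → NorthEastOf-antisym
       (connected⇒NorthEastOf-SWCorner connected (c∈τ , Sc∉τ , Wc∉τ) c′∈τ)
       (connected⇒NorthEastOf-SWCorner connected (c′∈τ , Sc′∉τ , Wc′∉τ) c∈τ))
    , (λ c c′ c∈τ Nc∉τ Ec∉τ c′∈τ Nc′∉τ Ec′∉τ → NorthEastOf-antisym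
       (connected⇒SouthWestOf-NECorner connected (c′∈τ , Nc′∉τ , Ec′∉τ) c∈τ)
       (connected⇒SouthWestOf-NECorner connected (c∈τ , Nc∉τ , Ec∉τ) c′∈τ))

antidiagonal : Node → ℤ
antidiagonal (i , j) = i - j

antidiagonal-S : ∀ v → antidiagonal (S v) ≡ antidiagonal v + 1ℤ
antidiagonal-S (i , j) = [i+1]-j≡[i-j]+1 i j
  where
  [i+1]-j≡[i-j]+1 : ∀ (i j : ℤ) → i + 1ℤ - j ≡ i - j + 1ℤ
  [i+1]-j≡[i-j]+1 = solve-∀

antidiagonal-W : ∀ v → antidiagonal (W v) ≡ antidiagonal v + 1ℤ
antidiagonal-W (i , j) = i-[j-1]≡[i-j]+1 i j
  where
  i-[j-1]≡[i-j]+1 : ∀ (i j : ℤ) → i - (j - 1ℤ) ≡ i - j + 1ℤ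
  i-[j-1]≡[i-j]+1 = solve-∀

≡+1⇒+suc≡+ : ∀ {i j : ℤ} n → j ≡ i + 1ℤ → i + + suc n ≡ j + + n
≡+1⇒+suc≡+ {i} n refl = sym (ℤ.+-assoc i 1ℤ (+ n))

module _ (τ : List Node) where

  private
    Reaches-SWCorner : Node → Set
    Reaches-SWCorner v = ∃[ c ] IsSWCorner τ c × Walk τ v c

    -- n bounds the number of south/west steps still possible from v
    Fuel : ℕ → Node → Set
    Fuel n v = ∀ {x} → x ∈ τ → antidiagonal x ≤ antidiagonal v + + n

  mutual
    private
      descend : ∀ n {v} → v ∈ τ → Fuel n v → Reaches-SWCorner v
      descend n {v} v∈τ fuel with S v ∈? τ | W v ∈? τ
      ... | yes Sv∈τ | _        =
        descend-via n v∈τ (inj₂ (inj₂ (inj₁ refl))) Sv∈τ (antidiagonal-S v) fuel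
      ... | no _     | yes Wv∈τ =
        descend-via n v∈τ (inj₂ (inj₂ (inj₂ refl))) Wv∈τ (antidiagonal-W v) fuel
      ... | no Sv∉τ  | no Wv∉τ  = v , (v∈τ , Sv∉τ , Wv∉τ) , here v∈τ

      descend-via : ∀ n {v w} → v ∈ τ → Adjacent v w → w ∈ τ
                  → antidiagonal w ≡ antidiagonal v + 1ℤ → Fuel n v → Reaches-SWCorner v
      descend-via zero {v} _ _ w∈τ w-higher fuel =
        ⊥-elim (ℤ.<⇒≱ (ℤ.+-monoʳ-< (antidiagonal v) (+<+ (s≤s z≤n)))
                      (subst (_≤ _) w-higher (fuel w∈τ)))
      descend-via (suc n) {v} v∈τ adj w∈τ w-higher fuel
        with descend n w∈τ (λ x∈τ → subst (_ ≤_) (≡+1⇒+suc≡+ {antidiagonal v} n w-higher) (fuel x∈τ))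
      ... | c , corner , walk = c , corner , step v∈τ adj walk

  reaches-SWCorner : ∀ {v} → v ∈ τ → ∃[ c ] IsSWCorner τ c × Walk τ v c
  reaches-SWCorner {v} v∈τ = descend ∣ bound - antidiagonal v ∣ v∈τ
    (λ x∈τ → ℤ.≤-trans (bounded x∈τ) (i≤j+∣i-j∣ bound (antidiagonal v)))
    where
    bound : ℤ
    bound = max 0ℤ (map antidiagonal τ)
    bounded : ∀ {x} → x ∈ τ → antidiagonal x ≤ bound
    bounded = All.lookup (map⁻ (xs≤max 0ℤ (map antidiagonal τ)))

  cornered⇒connected : IsCornered τ → IsConnected τ
  cornered⇒connected (SWCorner-unique , _) u v u∈τ v∈τ
    with reaches-SWCorner u∈τ | reaches-SWCorner v∈τ
  ... | c , (c∈τ , Sc∉τ , Wc∉τ) , u⇝c | c′ , (c′∈τ , Sc′∉τ , Wc′∉τ) , v⇝c′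
    with SWCorner-unique c c′ c∈τ Sc∉τ Wc∉τ c′∈τ Sc′∉τ Wc′∉τ
  ... | refl = u⇝c ++ʷ reverse v⇝c′

lemma2p3 : (τ : List Node) → IsSkewShape τ
    → (IsCornered τ → IsConnected τ) × (IsConnected τ → IsCornered τ)
lemma2p3 τ skew = cornered⇒connected τ , connected⇒cornered skew
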